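{- Let $p$ be a point and $R$ a path. Then $(R^{\top})^*\mathbin{;}p\cap R$ is a path, $\mathrm{sp}((R^{\top})^*\mathbin{;}p\cap R)\subseteq p$, and $\mathrm{ep}((R^{\top})^*\mathbin{;}p\cap R)\subseteq\mathrm{ep}(R)$.
   Context: $(B,\cup,\mathbin{;},\overline{\,\cdot\,},{}^{\top},{}^{*},\mathsf{I})$ is a Kleene relation algebra; all variables range over $B$. That is, $(B,\cup,\mathbin{;},\overline{\,\cdot\,},{}^{\top},\mathsf{I})$ is a relation algebra: $\cup$ is associative and commutative and $R=\overline{\overline{R}\cup\overline{S}}\cup\overline{\overline{R}\cup S}$; $\mathbin{;}$ is associative, $(R\cup S)\mathbin{;}T=R\mathbin{;}T\cup S\mathbin{;}T$, $R\mathbin{;}\mathsf{I}=R$; $(R^{\top})^{\top}=R$, $(R\cup S)^{\top}=R^{\top}\cup S^{\top}$, $(R\mathbin{;}S)^{\top}=S^{\top}\mathbin{;}R^{\top}$; $R^{\top}\mathbin{;}\overline{R\mathbin{;}S}\cup\overline{S}=\overline{S}$. The order is $R\subseteq S$ iff $R\cup S=S$; $R\cap S=\overline{\overline{R}\cup\overline{S}}$; $\mathsf{L}=R\cup\overline{R}$ is the greatest and $\mathsf{O}=R\cap\overline{R}$ the least element. The star satisfies $\mathsf{I}\cup R\mathbin{;}R^*\subseteq R^*$, $\mathsf{I}\cup R^*\mathbin{;}R\subseteq R^*$, $S\cup R\mathbin{;}Q\subseteq Q\Rightarrow R^*\mathbin{;}S\subseteq Q$, $S\cup Q\mathbin{;}R\subseteq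 Q\Rightarrow S\mathbin{;}R^*\subseteq Q$. Write $R^{\top*}=(R^{\top})^*$. The algebra satisfies the Tarski rule ($R\neq\mathsf{O}$ iff $\mathsf{L}\mathbin{;}R\mathbin{;}\mathsf{L}=\mathsf{L}$) and the point axiom (for every $R\neq\mathsf{O}$ there are points $p,q$ with $p\mathbin{;}q^{\top}\subseteq R$). A point is an element $p$ with $p=p\mathbin{;}\mathsf{L}$, $p\mathbin{;}p^{\top}\subseteq\mathsf{I}$ and $\mathsf{I}\subseteq p^{\top}\mathbin{;}p$. Composition binds tighter than $\cup,\cap$; complement and converse bind tighter than composition. $R$ is univalent if $R^{\top}\mathbin{;}R\subseteq\mathsf{I}$ and injective if $R\mathbin{;}R^{\top}\subseteq\mathsf{I}$. $R$ is connected if $R\mathbin{;}\mathsf{L}\mathbin{;}R\subseteq R^*\cup R^{\top*}$; $R$ is a path if it is injective, univalent and connected. $\mathrm{sp}(R)=R\mathbin{;}\mathsf{L}\cap\overline{R^{\top}\mathbin{;}\mathsf{L}}$ and $\mathrm{ep}(R)=R^{\top}\mathbin{;}\mathsf{L}\cap\overline{R\mathbin{;}\mathsf{L}}$. -}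

module Defs where

open import Level using (Level; suc; _⊔_)
open import Relation.Binary.PropositionalEquality using (_≡_)
open import Relation.Nullary using (¬_)
open import Data.Product using (Σ; _×_)
open import Function.Bundles using (_⇔_)

record KleeneRelationAlgebra (c : Level) : Set (suc c) where
  infixr 5 _∪_ _∩_
  infixr 7 _⨾_
  infix 4 _⊆_
  field
    B    : Set c
    _∪_  : B → B → B
    _⨾_  : B → B → B
    ∁    : B → B
    _ᵀ   : B → B
    _*   : B → B
    I    : B

  _⊆_ : B → B → Set c
  R ⊆ S = (R ∪ S) ≡ S

  _∩_ : B → B → B
  R ∩ S = ∁ (∁ R ∪ ∁ S)

  -- greatest and least element (independent of the chosen R by the axioms)
  L : B
  L = I ∪ ∁ I

  O : B
  O = I ∩ ∁ I

  IsPoint : B → Set c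
  IsPoint p = (p ≡ p ⨾ L) × (p ⨾ (p ᵀ) ⊆ I) × (I ⊆ (p ᵀ) ⨾ p)

  field
    ∪-assoc    : ∀ R S T → (R ∪ S) ∪ T ≡ R ∪ (S ∪ T)
    ∪-comm     : ∀ R S → R ∪ S ≡ S ∪ R
    huntington : ∀ R S → R ≡ ∁ (∁ R ∪ ∁ S) ∪ ∁ (∁ R ∪ S)
    ⨾-assoc    : ∀ R S T → (R ⨾ S) ⨾ T ≡ R ⨾ (S ⨾ T)
    ⨾-distribʳ : ∀ R S T → (R ∪ S) ⨾ T ≡ (R ⨾ T) ∪ (S ⨾ T)
    ⨾-identityʳ : ∀ R → R ⨾ I ≡ R
    ᵀ-involutive : ∀ R → (R ᵀ) ᵀ ≡ R
    ᵀ-∪        : ∀ R S → (R ∪ S) ᵀ ≡ (R ᵀ) ∪ (S ᵀ)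
    ᵀ-⨾        : ∀ R S → (R ⨾ S) ᵀ ≡ (S ᵀ) ⨾ (R ᵀ)
    schroeder  : ∀ R S → ((R ᵀ) ⨾ ∁ (R ⨾ S)) ∪ ∁ S ≡ ∁ S
    star-unfoldˡ : ∀ R → I ∪ (R ⨾ (R *)) ⊆ R *
    star-unfoldʳ : ∀ R → I ∪ ((R *) ⨾ R) ⊆ R *
    star-inductˡ : ∀ R S Q → S ∪ (R ⨾ Q) ⊆ Q → (R *) ⨾ S ⊆ Q
    star-inductʳ : ∀ R S Q → S ∪ (Q ⨾ R) ⊆ Q → S ⨾ (R *) ⊆ Q
    tarski     : ∀ R → (¬ (R ≡ O)) ⇔ ((L ⨾ R) ⨾ L ≡ L)
    point-axiom : ∀ R → ¬ (R ≡ O) →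
                  Σ B (λ p → Σ B (λ q → IsPoint p × IsPoint q × (p ⨾ (q ᵀ) ⊆ R)))

  _ᵀ* : B → B
  R ᵀ* = (R ᵀ) *

  IsUnivalent : B → Set c
  IsUnivalent R = (R ᵀ) ⨾ R ⊆ I

  IsInjective : B → Set c
  IsInjective R = R ⨾ (R ᵀ) ⊆ I

  IsConnected : B → Set c
  IsConnected R = R ⨾ L ⨾ R ⊆ (R *) ∪ (R ᵀ*)

  IsPath : B → Set c
  IsPath R = IsInjective R × IsUnivalent R × IsConnected R

  sp : B → B
  sp R = (R ⨾ L) ∩ ∁ ((R ᵀ) ⨾ L)

  ep : B → B
  ep R = ((R ᵀ) ⨾ L) ∩ ∁ (R ⨾ L)

-- Put v = R^{⊤*} ; p, the vector of points from which p is reachable along R, and d = v ∩ I.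
-- Then v is closed under R^⊤, so the restriction S = v ∩ R = d ; R also satisfies S ⊆ S ; d:
-- both ends of an S-edge lie in v.  Hence S is a sub-relation of R (so injective and
-- univalent), and d ; R* ⊆ S* ; d and R^{⊤*} ; d ⊆ d ; S^{⊤*} by star induction, which
-- carries connectedness from S ; L ; S = d ; (R ; L ; R) ; d over to S.  Its start points lie
-- in v but not in R^⊤ ; v, hence in p because v = p ∪ R^⊤ ; v; its end points are end points
-- of R because S^⊤ ; L ⊆ v.  Of the point axioms for p only p = p ; L is needed.
module Submission where

open import Defs
open import Level using (Level)
open import Data.Product using (_×_; _,_)
open import Algebra.Bundles using (CommutativeSemigroup)
import Algebra.Properties.CommutativeSemigroup as CommutativeSemigroupProperties
open import Relation.Binary.Bundles using (Poset)
import Relation.Binary.Reasoning.PartialOrder as PartialOrderReasoning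
open import Relation.Binary.PropositionalEquality
  using (_≡_; sym; trans; cong; cong₂; subst; subst₂; isEquivalence; module ≡-Reasoning)

module KleeneRelationAlgebraProperties {c : Level} (K : KleeneRelationAlgebra c) where
  open KleeneRelationAlgebra K

  -- Boolean algebra laws from Huntington's axiom

  ∪-commutativeSemigroup : CommutativeSemigroup c c
  ∪-commutativeSemigroup = record
    { Carrier = B
    ; _≈_ = _≡_
    ; _∙_ = _∪_
    ; isCommutativeSemigroup = record
      { isSemigroup = record
        { isMagma = record { isEquivalence = isEquivalence ; ∙-cong = cong₂ _∪_ }
        ; assoc = ∪-assoc
        }
      ; comm = ∪-comm
      }
    }

  open CommutativeSemigroupProperties ∪-commutativeSemigroup
    using () renaming (interchange to ∪-interchange)

  private
    ∪-∁≡∁∁-∪-∁ : ∀ x → x ∪ ∁ x ≡ ∁ (∁ x) ∪ ∁ x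
    ∪-∁≡∁∁-∪-∁ x = begin
      x ∪ x′                                     ≡⟨ cong₂ _∪_ (huntington x x″) (huntington x′ x″) ⟩
      (∁ (x′ ∪ x‴) ∪ ∁ (x′ ∪ x″)) ∪ (∁ (x″ ∪ x‴) ∪ ∁ (x″ ∪ x″))
                                                 ≡⟨ ∪-interchange _ _ _ _ ⟩
      (∁ (x′ ∪ x‴) ∪ ∁ (x″ ∪ x‴)) ∪ (∁ (x′ ∪ x″) ∪ ∁ (x″ ∪ x″))
                                                 ≡⟨ cong₂ _∪_ (∪-comm _ _) (∪-comm _ _) ⟩
      (∁ (x″ ∪ x‴) ∪ ∁ (x′ ∪ x‴)) ∪ (∁ (x″ ∪ x″) ∪ ∁ (x′ ∪ x″))
                                                 ≡⟨ cong₂ _∪_ (cong₂ (λ s t → ∁ s ∪ ∁ t) (∪-comm x″ x‴) (∪-comm x′ x‴))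
                                                              (cong (λ t → ∁ (x″ ∪ x″) ∪ ∁ t) (∪-comm x′ x″)) ⟩
      (∁ (x‴ ∪ x″) ∪ ∁ (x‴ ∪ x′)) ∪ (∁ (x″ ∪ x″) ∪ ∁ (x″ ∪ x′))
                                                 ≡⟨ sym (cong₂ _∪_ (huntington x″ x′) (huntington x′ x′)) ⟩
      x″ ∪ x′                                    ∎
      where
      open ≡-Reasoning
      x′ = ∁ x
      x″ = ∁ x′
      x‴ = ∁ x″

  ∁-involutive : ∀ x → ∁ (∁ x) ≡ x
  ∁-involutive x = begin
    x″                             ≡⟨ huntington x″ x′ ⟩
    ∁ (x‴ ∪ x″) ∪ ∁ (x‴ ∪ x′)      ≡⟨ cong₂ (λ s t → ∁ s ∪ ∁ t) (sym (∪-∁≡∁∁-∪-∁ x′)) (∪-comm x‴ x′) ⟩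
    ∁ (x′ ∪ x″) ∪ ∁ (x′ ∪ x‴)      ≡⟨ ∪-comm _ _ ⟩
    ∁ (x′ ∪ x‴) ∪ ∁ (x′ ∪ x″)      ≡⟨ sym (huntington x x″) ⟩
    x                              ∎
    where
    open ≡-Reasoning
    x′ = ∁ x
    x″ = ∁ x′
    x‴ = ∁ x″

  huntington-∁ : ∀ x y → ∁ x ≡ ∁ (x ∪ ∁ y) ∪ ∁ (x ∪ y)
  huntington-∁ x y = trans (huntington (∁ x) y) (cong (λ t → ∁ (t ∪ ∁ y) ∪ ∁ (t ∪ y)) (∁-involutive x))

  ∪-complementʳ : ∀ x → x ∪ ∁ x ≡ L
  ∪-complementʳ x = begin
    x ∪ ∁ x
      ≡⟨ cong₂ _∪_ (huntington x I) (huntington-∁ x I) ⟩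
    (∁ (∁ x ∪ ∁ I) ∪ ∁ (∁ x ∪ I)) ∪ (∁ (x ∪ ∁ I) ∪ ∁ (x ∪ I))
      ≡⟨ ∪-interchange _ _ _ _ ⟩
    (∁ (∁ x ∪ ∁ I) ∪ ∁ (x ∪ ∁ I)) ∪ (∁ (∁ x ∪ I) ∪ ∁ (x ∪ I))
      ≡⟨ cong₂ _∪_ (cong₂ (λ s t → ∁ s ∪ ∁ t) (∪-comm (∁ x) (∁ I)) (∪-comm x (∁ I)))
                   (cong₂ (λ s t → ∁ s ∪ ∁ t) (∪-comm (∁ x) I) (∪-comm x I)) ⟩
    (∁ (∁ I ∪ ∁ x) ∪ ∁ (∁ I ∪ x)) ∪ (∁ (I ∪ ∁ x) ∪ ∁ (I ∪ x))
      ≡⟨ sym (cong₂ _∪_ (huntington I x) (huntington-∁ I x)) ⟩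
    I ∪ ∁ I ∎
    where open ≡-Reasoning

  O≡∁L : O ≡ ∁ L
  O≡∁L = cong ∁ (∪-complementʳ (∁ I))

  ∪-identityʳ : ∀ x → x ∪ O ≡ x
  ∪-identityʳ x = begin
    x ∪ O                ≡⟨ cong₂ _∪_ (∁∁-via-∪-self x) O≡∁L ⟩
    (y ∪ ∁ L) ∪ ∁ L      ≡⟨ ∪-assoc y (∁ L) (∁ L) ⟩
    y ∪ (∁ L ∪ ∁ L)      ≡⟨ cong (y ∪_) ∁L-∪-idem ⟩
    y ∪ ∁ L              ≡⟨ sym (∁∁-via-∪-self x) ⟩
    x                    ∎
    where
    open ≡-Reasoning
    y = ∁ (∁ x ∪ ∁ x)

    ∁-via-∪-self : ∀ z → ∁ z ≡ ∁ (z ∪ z) ∪ ∁ L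
    ∁-via-∪-self z = begin
      ∁ z                                        ≡⟨ huntington (∁ z) (∁ z) ⟩
      ∁ (∁ (∁ z) ∪ ∁ (∁ z)) ∪ ∁ (∁ (∁ z) ∪ ∁ z)  ≡⟨ cong (λ t → ∁ (t ∪ t) ∪ ∁ (t ∪ ∁ z)) (∁-involutive z) ⟩
      ∁ (z ∪ z) ∪ ∁ (z ∪ ∁ z)                    ≡⟨ cong (λ t → ∁ (z ∪ z) ∪ ∁ t) (∪-complementʳ z) ⟩
      ∁ (z ∪ z) ∪ ∁ L                            ∎

    ∁∁-via-∪-self : ∀ z → z ≡ ∁ (∁ z ∪ ∁ z) ∪ ∁ L
    ∁∁-via-∪-self z = trans (sym (∁-involutive z)) (∁-via-∪-self (∁ z))

    L-∪-idem : L ∪ L ≡ L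
    L-∪-idem = begin
      L ∪ L                    ≡⟨ cong (L ∪_) L≡L∪∁[L∪L] ⟩
      L ∪ (L ∪ ∁ (L ∪ L))      ≡⟨ sym (∪-assoc L L _) ⟩
      (L ∪ L) ∪ ∁ (L ∪ L)      ≡⟨ ∪-complementʳ (L ∪ L) ⟩
      L                        ∎
      where
      L≡L∪∁[L∪L] : L ≡ L ∪ ∁ (L ∪ L)
      L≡L∪∁[L∪L] = begin
        L                                       ≡⟨ huntington L (L ∪ L) ⟩
        ∁ (∁ L ∪ ∁ (L ∪ L)) ∪ ∁ (∁ L ∪ (L ∪ L))  ≡⟨ cong₂ (λ s t → ∁ s ∪ ∁ t) absorb-∁ absorb ⟩
        ∁ (∁ L) ∪ ∁ (L ∪ L)                     ≡⟨ cong (_∪ ∁ (L ∪ L)) (∁-involutive L) ⟩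
        L ∪ ∁ (L ∪ L)                           ∎
        where
        absorb-∁ : ∁ L ∪ ∁ (L ∪ L) ≡ ∁ L
        absorb-∁ = trans (∪-comm _ _) (sym (∁-via-∪-self L))
        absorb : ∁ L ∪ (L ∪ L) ≡ L ∪ L
        absorb = trans (sym (∪-assoc (∁ L) L L)) (cong (_∪ L) (trans (∪-comm (∁ L) L) (∪-complementʳ L)))

    ∁L-∪-idem : ∁ L ∪ ∁ L ≡ ∁ L
    ∁L-∪-idem = sym (trans (∁-via-∪-self L) (cong (λ t → ∁ t ∪ ∁ L) L-∪-idem))

  ∪-idem : ∀ x → x ∪ x ≡ x
  ∪-idem x = begin
    x ∪ x              ≡⟨ sym (∁-involutive (x ∪ x)) ⟩
    ∁ (∁ (x ∪ x))      ≡⟨ cong ∁ ∁[x∪x]≡∁x ⟩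
    ∁ (∁ x)            ≡⟨ ∁-involutive x ⟩
    x                  ∎
    where
    open ≡-Reasoning
    ∁[x∪x]≡∁x : ∁ (x ∪ x) ≡ ∁ x
    ∁[x∪x]≡∁x = begin
      ∁ (x ∪ x)                                  ≡⟨ sym (∪-identityʳ _) ⟩
      ∁ (x ∪ x) ∪ O                              ≡⟨ cong (∁ (x ∪ x) ∪_) (trans O≡∁L (cong ∁ (sym (∪-complementʳ x)))) ⟩
      ∁ (x ∪ x) ∪ ∁ (x ∪ ∁ x)                    ≡⟨ cong (λ t → ∁ (t ∪ t) ∪ ∁ (t ∪ ∁ x)) (sym (∁-involutive x)) ⟩
      ∁ (∁ (∁ x) ∪ ∁ (∁ x)) ∪ ∁ (∁ (∁ x) ∪ ∁ x)  ≡⟨ sym (huntington (∁ x) (∁ x)) ⟩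
      ∁ x                                        ∎

  ⊆-refl : ∀ x → x ⊆ x
  ⊆-refl = ∪-idem

  ≡⇒⊆ : ∀ {x y} → x ≡ y → x ⊆ y
  ≡⇒⊆ {x} x≡y = subst (x ⊆_) x≡y (⊆-refl x)

  ⊆-trans : ∀ {x y z} → x ⊆ y → y ⊆ z → x ⊆ z
  ⊆-trans {x} {y} {z} x⊆y y⊆z = begin
    x ∪ z          ≡⟨ cong (x ∪_) (sym y⊆z) ⟩
    x ∪ (y ∪ z)    ≡⟨ sym (∪-assoc x y z) ⟩
    (x ∪ y) ∪ z    ≡⟨ cong (_∪ z) x⊆y ⟩
    y ∪ z          ≡⟨ y⊆z ⟩
    z              ∎
    where open ≡-Reasoning

  ⊆-antisym : ∀ {x y} → x ⊆ y → y ⊆ x → x ≡ y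
  ⊆-antisym {x} {y} x⊆y y⊆x = trans (sym y⊆x) (trans (∪-comm y x) x⊆y)

  ⊆-poset : Poset c c c
  ⊆-poset = record
    { Carrier = B
    ; _≈_ = _≡_
    ; _≤_ = _⊆_
    ; isPartialOrder = record
      { isPreorder = record { isEquivalence = isEquivalence ; reflexive = ≡⇒⊆ ; trans = ⊆-trans }
      ; antisym = ⊆-antisym
      }
    }

  module ⊆-Reasoning = PartialOrderReasoning ⊆-poset

  O-least : ∀ x → O ⊆ x
  O-least x = trans (∪-comm O x) (∪-identityʳ x)

  L-greatest : ∀ x → x ⊆ L
  L-greatest x = begin
    x ∪ L              ≡⟨ cong (x ∪_) (sym (∪-complementʳ x)) ⟩
    x ∪ (x ∪ ∁ x)      ≡⟨ sym (∪-assoc x x (∁ x)) ⟩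
    (x ∪ x) ∪ ∁ x      ≡⟨ cong (_∪ ∁ x) (∪-idem x) ⟩
    x ∪ ∁ x            ≡⟨ ∪-complementʳ x ⟩
    L                  ∎
    where open ≡-Reasoning

  ∪-upperˡ : ∀ x y → x ⊆ x ∪ y
  ∪-upperˡ x y = trans (sym (∪-assoc x x y)) (cong (_∪ y) (∪-idem x))

  ∪-upperʳ : ∀ x y → y ⊆ x ∪ y
  ∪-upperʳ x y = subst (y ⊆_) (∪-comm y x) (∪-upperˡ y x)

  ∪-lub : ∀ {x y z} → x ⊆ z → y ⊆ z → x ∪ y ⊆ z
  ∪-lub {x} {y} {z} x⊆z y⊆z = trans (∪-assoc x y z) (trans (cong (x ∪_) y⊆z) x⊆z)

  ∪-mono : ∀ {x y x′ y′} → x ⊆ x′ → y ⊆ y′ → x ∪ y ⊆ x′ ∪ y′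
  ∪-mono {x′ = x′} {y′} x⊆x′ y⊆y′ =
    ∪-lub (⊆-trans x⊆x′ (∪-upperˡ x′ y′)) (⊆-trans y⊆y′ (∪-upperʳ x′ y′))

  ∁-antitone : ∀ {x y} → x ⊆ y → ∁ y ⊆ ∁ x
  ∁-antitone {x} {y} x⊆y = begin
    ∁ y ∪ ∁ x              ≡⟨ cong (∁ y ∪_) ∁x≡e∪∁y ⟩
    ∁ y ∪ (e ∪ ∁ y)        ≡⟨ ∪-comm (∁ y) (e ∪ ∁ y) ⟩
    (e ∪ ∁ y) ∪ ∁ y        ≡⟨ ∪-assoc e (∁ y) (∁ y) ⟩
    e ∪ (∁ y ∪ ∁ y)        ≡⟨ cong (e ∪_) (∪-idem (∁ y)) ⟩
    e ∪ ∁ y                ≡⟨ sym ∁x≡e∪∁y ⟩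
    ∁ x                    ∎
    where
    open ≡-Reasoning
    e = ∁ (x ∪ ∁ y)
    ∁x≡e∪∁y : ∁ x ≡ e ∪ ∁ y
    ∁x≡e∪∁y = trans (huntington-∁ x y) (cong (λ t → e ∪ ∁ t) x⊆y)

  ∩-lowerˡ : ∀ x y → x ∩ y ⊆ x
  ∩-lowerˡ x y = subst (x ∩ y ⊆_) (∁-involutive x) (∁-antitone (∪-upperˡ (∁ x) (∁ y)))

  ∩-lowerʳ : ∀ x y → x ∩ y ⊆ y
  ∩-lowerʳ x y = subst (x ∩ y ⊆_) (∁-involutive y) (∁-antitone (∪-upperʳ (∁ x) (∁ y)))

  ∩-glb : ∀ {x y z} → z ⊆ x → z ⊆ y → z ⊆ x ∩ y
  ∩-glb {z = z} z⊆x z⊆y =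
    subst (_⊆ _) (∁-involutive z) (∁-antitone (∪-lub (∁-antitone z⊆x) (∁-antitone z⊆y)))

  ∩-mono : ∀ {x y x′ y′} → x ⊆ x′ → y ⊆ y′ → x ∩ y ⊆ x′ ∩ y′
  ∩-mono {x} {y} x⊆x′ y⊆y′ = ∩-glb (⊆-trans (∩-lowerˡ x y) x⊆x′) (⊆-trans (∩-lowerʳ x y) y⊆y′)

  ∩-comm : ∀ x y → x ∩ y ≡ y ∩ x
  ∩-comm x y = cong ∁ (∪-comm (∁ x) (∁ y))

  ∩-identityʳ : ∀ x → x ∩ L ≡ x
  ∩-identityʳ x = ⊆-antisym (∩-lowerˡ x L) (∩-glb (⊆-refl x) (L-greatest x))

  ∩-complementʳ : ∀ x → x ∩ ∁ x ≡ O
  ∩-complementʳ x = trans (cong ∁ (∪-complementʳ (∁ x))) (sym O≡∁L)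

  ∁-∪ : ∀ x y → ∁ (x ∪ y) ≡ ∁ x ∩ ∁ y
  ∁-∪ x y = sym (cong₂ (λ s t → ∁ (s ∪ t)) (∁-involutive x) (∁-involutive y))

  ⊆-by-cases : ∀ {x z} y → x ∩ y ⊆ z → x ∩ ∁ y ⊆ z → x ⊆ z
  ⊆-by-cases {x} {z} y x∩y⊆z x∩∁y⊆z = subst (_⊆ z) (sym x≡split) (∪-lub x∩y⊆z x∩∁y⊆z)
    where
    x≡split : x ≡ (x ∩ y) ∪ (x ∩ ∁ y)
    x≡split = trans (huntington x y) (cong (λ t → (x ∩ y) ∪ ∁ (∁ x ∪ t)) (sym (∁-involutive y)))

  ⊆-∩-∁⇒⊆O : ∀ {x y} → x ⊆ y → x ⊆ ∁ y → x ⊆ O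
  ⊆-∩-∁⇒⊆O {y = y} x⊆y x⊆∁y = ⊆-trans (∩-glb x⊆y x⊆∁y) (≡⇒⊆ (∩-complementʳ y))

  disjoint⇒⊆∁ : ∀ {x y} → x ∩ y ⊆ O → x ⊆ ∁ y
  disjoint⇒⊆∁ {y = y} x∩y⊆O = ⊆-by-cases y (⊆-trans x∩y⊆O (O-least (∁ y))) (∩-lowerʳ _ (∁ y))

  shunting : ∀ {x y z} → x ⊆ y ∪ z → x ∩ ∁ z ⊆ y
  shunting {x} {y} {z} x⊆y∪z = ⊆-by-cases y (∩-lowerʳ _ y) (⊆-trans contradictory (O-least y))
    where
    w = (x ∩ ∁ z) ∩ ∁ y
    contradictory : w ⊆ O
    contradictory = ⊆-∩-∁⇒⊆O
      (⊆-trans (∩-lowerˡ _ _) (⊆-trans (∩-lowerˡ x (∁ z)) x⊆y∪z))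
      (subst (w ⊆_) (sym (∁-∪ y z))
        (∩-glb (∩-lowerʳ _ (∁ y)) (⊆-trans (∩-lowerˡ _ _) (∩-lowerʳ x (∁ z)))))

  complement-unique : ∀ {x y} → x ∪ y ≡ L → x ∩ y ⊆ O → y ≡ ∁ x
  complement-unique {x} {y} x∪y≡L x∩y⊆O = ⊆-antisym
    (disjoint⇒⊆∁ (subst (_⊆ O) (∩-comm x y) x∩y⊆O))
    (⊆-by-cases y (∩-lowerʳ (∁ x) y) (subst (_⊆ y) ∁x∩∁y≡O (O-least y)))
    where
    ∁x∩∁y≡O : O ≡ ∁ x ∩ ∁ y
    ∁x∩∁y≡O = trans O≡∁L (trans (cong ∁ (sym x∪y≡L)) (∁-∪ x y))

  ᵀ-mono : ∀ {x y} → x ⊆ y → x ᵀ ⊆ y ᵀ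
  ᵀ-mono {x} {y} x⊆y = trans (sym (ᵀ-∪ x y)) (cong _ᵀ x⊆y)

  ᵀ-reflects-⊆ : ∀ {x y} → x ᵀ ⊆ y ᵀ → x ⊆ y
  ᵀ-reflects-⊆ {x} {y} xᵀ⊆yᵀ = subst₂ _⊆_ (ᵀ-involutive x) (ᵀ-involutive y) (ᵀ-mono xᵀ⊆yᵀ)

  ᵀ-⨾-ᵀ : ∀ x y → (y ᵀ ⨾ x ᵀ) ᵀ ≡ x ⨾ y
  ᵀ-⨾-ᵀ x y = trans (ᵀ-⨾ (y ᵀ) (x ᵀ)) (cong₂ _⨾_ (ᵀ-involutive x) (ᵀ-involutive y))

  ᵀ-I : I ᵀ ≡ I
  ᵀ-I = begin
    I ᵀ                  ≡⟨ sym (⨾-identityʳ (I ᵀ)) ⟩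
    I ᵀ ⨾ I              ≡⟨ sym (ᵀ-⨾-ᵀ (I ᵀ) I) ⟩
    (I ᵀ ⨾ (I ᵀ) ᵀ) ᵀ    ≡⟨ cong (λ t → (I ᵀ ⨾ t) ᵀ) (ᵀ-involutive I) ⟩
    (I ᵀ ⨾ I) ᵀ          ≡⟨ cong _ᵀ (⨾-identityʳ (I ᵀ)) ⟩
    (I ᵀ) ᵀ              ≡⟨ ᵀ-involutive I ⟩
    I                    ∎
    where open ≡-Reasoning

  ⨾-identityˡ : ∀ x → I ⨾ x ≡ x
  ⨾-identityˡ x = begin
    I ⨾ x              ≡⟨ sym (ᵀ-⨾-ᵀ I x) ⟩
    (x ᵀ ⨾ I ᵀ) ᵀ      ≡⟨ cong (λ t → (x ᵀ ⨾ t) ᵀ) ᵀ-I ⟩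
    (x ᵀ ⨾ I) ᵀ        ≡⟨ cong _ᵀ (⨾-identityʳ (x ᵀ)) ⟩
    (x ᵀ) ᵀ            ≡⟨ ᵀ-involutive x ⟩
    x                  ∎
    where open ≡-Reasoning

  ⨾-distribˡ : ∀ x y z → x ⨾ (y ∪ z) ≡ (x ⨾ y) ∪ (x ⨾ z)
  ⨾-distribˡ x y z = begin
    x ⨾ (y ∪ z)                        ≡⟨ sym (ᵀ-⨾-ᵀ x (y ∪ z)) ⟩
    ((y ∪ z) ᵀ ⨾ x ᵀ) ᵀ                ≡⟨ cong (λ t → (t ⨾ x ᵀ) ᵀ) (ᵀ-∪ y z) ⟩
    ((y ᵀ ∪ z ᵀ) ⨾ x ᵀ) ᵀ              ≡⟨ cong _ᵀ (⨾-distribʳ (y ᵀ) (z ᵀ) (x ᵀ)) ⟩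
    ((y ᵀ ⨾ x ᵀ) ∪ (z ᵀ ⨾ x ᵀ)) ᵀ      ≡⟨ ᵀ-∪ _ _ ⟩
    (y ᵀ ⨾ x ᵀ) ᵀ ∪ (z ᵀ ⨾ x ᵀ) ᵀ      ≡⟨ cong₂ _∪_ (ᵀ-⨾-ᵀ x y) (ᵀ-⨾-ᵀ x z) ⟩
    (x ⨾ y) ∪ (x ⨾ z)                  ∎
    where open ≡-Reasoning

  ⨾-monoˡ : ∀ {x y} z → x ⊆ y → x ⨾ z ⊆ y ⨾ z
  ⨾-monoˡ {x} {y} z x⊆y = trans (sym (⨾-distribʳ x y z)) (cong (_⨾ z) x⊆y)

  ⨾-monoʳ : ∀ {x y} z → x ⊆ y → z ⨾ x ⊆ z ⨾ y
  ⨾-monoʳ {x} {y} z x⊆y = trans (sym (⨾-distribˡ z x y)) (cong (z ⨾_) x⊆y)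

  ⨾-mono : ∀ {x y x′ y′} → x ⊆ x′ → y ⊆ y′ → x ⨾ y ⊆ x′ ⨾ y′
  ⨾-mono {y = y} {x′} x⊆x′ y⊆y′ = ⊆-trans (⨾-monoˡ y x⊆x′) (⨾-monoʳ x′ y⊆y′)

  ⊆-⨾L : ∀ x → x ⊆ x ⨾ L
  ⊆-⨾L x = subst (_⊆ x ⨾ L) (⨾-identityʳ x) (⨾-monoʳ x (L-greatest I))

  ᵀ-L : L ᵀ ≡ L
  ᵀ-L = ⊆-antisym (L-greatest (L ᵀ)) (subst (_⊆ L ᵀ) (ᵀ-involutive L) (ᵀ-mono (L-greatest (L ᵀ))))

  ᵀ-∁ : ∀ x → (∁ x) ᵀ ≡ ∁ (x ᵀ)
  ᵀ-∁ x = complement-unique covering disjoint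
    where
    covering : x ᵀ ∪ (∁ x) ᵀ ≡ L
    covering = trans (sym (ᵀ-∪ x (∁ x))) (trans (cong _ᵀ (∪-complementʳ x)) ᵀ-L)
    w = x ᵀ ∩ (∁ x) ᵀ
    disjoint : w ⊆ O
    disjoint = ᵀ-reflects-⊆ (⊆-trans
      (⊆-∩-∁⇒⊆O (subst (w ᵀ ⊆_) (ᵀ-involutive x) (ᵀ-mono (∩-lowerˡ (x ᵀ) _)))
                (subst (w ᵀ ⊆_) (ᵀ-involutive (∁ x)) (ᵀ-mono (∩-lowerʳ _ ((∁ x) ᵀ)))))
      (O-least (O ᵀ)))

  ᵀ-∩ : ∀ x y → (x ∩ y) ᵀ ≡ x ᵀ ∩ y ᵀ
  ᵀ-∩ x y = begin
    (∁ (∁ x ∪ ∁ y)) ᵀ          ≡⟨ ᵀ-∁ _ ⟩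
    ∁ ((∁ x ∪ ∁ y) ᵀ)          ≡⟨ cong ∁ (ᵀ-∪ _ _) ⟩
    ∁ ((∁ x) ᵀ ∪ (∁ y) ᵀ)      ≡⟨ cong₂ (λ s t → ∁ (s ∪ t)) (ᵀ-∁ x) (ᵀ-∁ y) ⟩
    ∁ (∁ (x ᵀ) ∪ ∁ (y ᵀ))      ∎
    where open ≡-Reasoning

  ⨾-∩-modularˡ : ∀ x y z → (x ⨾ y) ∩ z ⊆ x ⨾ (y ∩ (x ᵀ ⨾ z))
  ⨾-∩-modularˡ x y z = subst (λ t → (x ⨾ y) ∩ t ⊆ x ⨾ inside) (∁-involutive z) (shunting x⨾y⊆)
    where
    inside = y ∩ (x ᵀ ⨾ z)
    outside = y ∩ ∁ (x ᵀ ⨾ z)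
    schroeder′ : x ⨾ ∁ (x ᵀ ⨾ z) ⊆ ∁ z
    schroeder′ = subst (λ t → t ⨾ ∁ (x ᵀ ⨾ z) ⊆ ∁ z) (ᵀ-involutive x) (schroeder (x ᵀ) z)
    x⨾y⊆ : x ⨾ y ⊆ (x ⨾ inside) ∪ ∁ z
    x⨾y⊆ = begin
      x ⨾ y                            ≈⟨ cong (x ⨾_) (⊆-antisym (⊆-by-cases (x ᵀ ⨾ z) (∪-upperˡ _ _) (∪-upperʳ _ _))
                                                                (∪-lub (∩-lowerˡ _ _) (∩-lowerˡ _ _))) ⟩
      x ⨾ (inside ∪ outside)           ≈⟨ ⨾-distribˡ x inside outside ⟩
      (x ⨾ inside) ∪ (x ⨾ outside)     ≤⟨ ∪-mono (⊆-refl _) (⊆-trans (⨾-monoʳ x (∩-lowerʳ y _)) schroeder′) ⟩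
      (x ⨾ inside) ∪ ∁ z               ∎
      where open ⊆-Reasoning

  ⨾-∩-modularʳ : ∀ x y z → (x ⨾ y) ∩ z ⊆ (x ∩ (z ⨾ y ᵀ)) ⨾ y
  ⨾-∩-modularʳ x y z = ᵀ-reflects-⊆ (subst₂ _⊆_ (sym lhsᵀ) (sym rhsᵀ) (⨾-∩-modularˡ (y ᵀ) (x ᵀ) (z ᵀ)))
    where
    lhsᵀ : ((x ⨾ y) ∩ z) ᵀ ≡ (y ᵀ ⨾ x ᵀ) ∩ z ᵀ
    lhsᵀ = trans (ᵀ-∩ _ _) (cong (_∩ z ᵀ) (ᵀ-⨾ x y))
    rhsᵀ : ((x ∩ (z ⨾ y ᵀ)) ⨾ y) ᵀ ≡ y ᵀ ⨾ (x ᵀ ∩ ((y ᵀ) ᵀ ⨾ z ᵀ))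
    rhsᵀ = trans (ᵀ-⨾ _ y) (cong (y ᵀ ⨾_) (trans (ᵀ-∩ x _) (cong (x ᵀ ∩_) (ᵀ-⨾ z (y ᵀ)))))

  IsInjective-⊆ : ∀ {x y} → x ⊆ y → IsInjective y → IsInjective x
  IsInjective-⊆ x⊆y y-injective = ⊆-trans (⨾-mono x⊆y (ᵀ-mono x⊆y)) y-injective

  IsUnivalent-⊆ : ∀ {x y} → x ⊆ y → IsUnivalent y → IsUnivalent x
  IsUnivalent-⊆ x⊆y y-univalent = ⊆-trans (⨾-mono (ᵀ-mono x⊆y) x⊆y) y-univalent

  I⊆* : ∀ x → I ⊆ x *
  I⊆* x = ⊆-trans (∪-upperˡ I _) (star-unfoldˡ x)

  ⨾*⊆* : ∀ x → x ⨾ x * ⊆ x *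
  ⨾*⊆* x = ⊆-trans (∪-upperʳ I _) (star-unfoldˡ x)

  *⨾⊆* : ∀ x → x * ⨾ x ⊆ x *
  *⨾⊆* x = ⊆-trans (∪-upperʳ I _) (star-unfoldʳ x)

  *-simulationˡ : ∀ {x y z} → x ⨾ z ⊆ z ⨾ y → x * ⨾ z ⊆ z ⨾ y *
  *-simulationˡ {x} {y} {z} x⨾z⊆z⨾y = star-inductˡ x z (z ⨾ y *) (∪-lub z⊆ step)
    where
    open ⊆-Reasoning
    z⊆ : z ⊆ z ⨾ y *
    z⊆ = subst (_⊆ z ⨾ y *) (⨾-identityʳ z) (⨾-monoʳ z (I⊆* y))
    step : x ⨾ (z ⨾ y *) ⊆ z ⨾ y *
    step = begin
      x ⨾ (z ⨾ y *)    ≈⟨ sym (⨾-assoc x z (y *)) ⟩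
      (x ⨾ z) ⨾ y *    ≤⟨ ⨾-monoˡ (y *) x⨾z⊆z⨾y ⟩
      (z ⨾ y) ⨾ y *    ≈⟨ ⨾-assoc z y (y *) ⟩
      z ⨾ (y ⨾ y *)    ≤⟨ ⨾-monoʳ z (⨾*⊆* y) ⟩
      z ⨾ y *          ∎

  *-simulationʳ : ∀ {x y z} → z ⨾ x ⊆ y ⨾ z → z ⨾ x * ⊆ y * ⨾ z
  *-simulationʳ {x} {y} {z} z⨾x⊆y⨾z = star-inductʳ x z (y * ⨾ z) (∪-lub z⊆ step)
    where
    open ⊆-Reasoning
    z⊆ : z ⊆ y * ⨾ z
    z⊆ = subst (_⊆ y * ⨾ z) (⨾-identityˡ z) (⨾-monoˡ z (I⊆* y))
    step : (y * ⨾ z) ⨾ x ⊆ y * ⨾ z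
    step = begin
      (y * ⨾ z) ⨾ x    ≈⟨ ⨾-assoc (y *) z x ⟩
      y * ⨾ (z ⨾ x)    ≤⟨ ⨾-monoʳ (y *) z⨾x⊆y⨾z ⟩
      y * ⨾ (y ⨾ z)    ≈⟨ sym (⨾-assoc (y *) y z) ⟩
      (y * ⨾ y) ⨾ z    ≤⟨ ⨾-monoˡ z (*⨾⊆* y) ⟩
      y * ⨾ z          ∎

  *-⨾-closed : ∀ x y → x ⨾ (x * ⨾ y) ⊆ x * ⨾ y
  *-⨾-closed x y = subst (_⊆ x * ⨾ y) (⨾-assoc x (x *) y) (⨾-monoˡ y (⨾*⊆* x))

  *-⨾-unfold : ∀ x y → x * ⨾ y ⊆ y ∪ x ⨾ (x * ⨾ y)
  *-⨾-unfold x y = star-inductˡ x y (y ∪ x ⨾ (x * ⨾ y)) (∪-mono (⊆-refl y) (⨾-monoʳ x x*⨾y-prefix))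
    where
    x*⨾y-prefix : y ∪ x ⨾ (x * ⨾ y) ⊆ x * ⨾ y
    x*⨾y-prefix = ∪-lub (subst (_⊆ x * ⨾ y) (⨾-identityˡ y) (⨾-monoˡ y (I⊆* x))) (*-⨾-closed x y)

  subidentity-⨾ˡ : ∀ {d} x → d ⊆ I → d ⨾ x ⊆ x
  subidentity-⨾ˡ {d} x d⊆I = subst (d ⨾ x ⊆_) (⨾-identityˡ x) (⨾-monoˡ x d⊆I)

  subidentity-⨾ʳ : ∀ {d} x → d ⊆ I → x ⨾ d ⊆ x
  subidentity-⨾ʳ {d} x d⊆I = subst (x ⨾ d ⊆_) (⨾-identityʳ x) (⨾-monoʳ x d⊆I)

  subidentity-ᵀ : ∀ {d} → d ⊆ I → d ᵀ ≡ d
  subidentity-ᵀ {d} d⊆I = ⊆-antisym (subst (d ᵀ ⊆_) (ᵀ-involutive d) (ᵀ-mono d⊆dᵀ)) d⊆dᵀ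
    where
    open ⊆-Reasoning
    d⊆dᵀ : d ⊆ d ᵀ
    d⊆dᵀ = begin
      d                          ≤⟨ ∩-glb (≡⇒⊆ (sym (⨾-identityʳ d))) d⊆I ⟩
      (d ⨾ I) ∩ I                ≤⟨ ⨾-∩-modularˡ d I I ⟩
      d ⨾ (I ∩ (d ᵀ ⨾ I))        ≤⟨ ⨾-monoʳ d (∩-lowerʳ I _) ⟩
      d ⨾ (d ᵀ ⨾ I)              ≈⟨ cong (d ⨾_) (⨾-identityʳ (d ᵀ)) ⟩
      d ⨾ d ᵀ                    ≤⟨ subidentity-⨾ˡ (d ᵀ) d⊆I ⟩
      d ᵀ                        ∎

  IsVector : B → Set c
  IsVector v = v ⨾ L ≡ v

  ⨾-vector : ∀ x {v} → IsVector v → IsVector (x ⨾ v)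
  ⨾-vector x {v} v-vector = trans (⨾-assoc x v L) (cong (x ⨾_) v-vector)

  vector-∩I-⨾ : ∀ {v} → IsVector v → ∀ x → (v ∩ I) ⨾ x ≡ v ∩ x
  vector-∩I-⨾ {v} v-vector x = ⊆-antisym ⊆v∩x v∩x⊆
    where
    open ⊆-Reasoning
    ⊆v∩x : (v ∩ I) ⨾ x ⊆ v ∩ x
    ⊆v∩x = ∩-glb (⊆-trans (⨾-mono (∩-lowerˡ v I) (L-greatest x)) (≡⇒⊆ v-vector))
                 (subidentity-⨾ˡ x (∩-lowerʳ v I))
    v∩x⊆ : v ∩ x ⊆ (v ∩ I) ⨾ x
    v∩x⊆ = begin
      v ∩ x                  ≈⟨ trans (∩-comm v x) (cong (_∩ v) (sym (⨾-identityˡ x))) ⟩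
      (I ⨾ x) ∩ v            ≤⟨ ⨾-∩-modularʳ I x v ⟩
      (I ∩ (v ⨾ x ᵀ)) ⨾ x    ≤⟨ ⨾-monoˡ x (∩-glb (⊆-trans (∩-lowerʳ I _) v⨾xᵀ⊆v) (∩-lowerˡ I _)) ⟩
      (v ∩ I) ⨾ x            ∎
      where
      v⨾xᵀ⊆v : v ⨾ x ᵀ ⊆ v
      v⨾xᵀ⊆v = ⊆-trans (⨾-monoʳ v (L-greatest (x ᵀ))) (≡⇒⊆ v-vector)

  -- Restriction of R to a vector closed under R ᵀ

  module Restriction (v R : B) (v-vector : IsVector v) (v-closed : R ᵀ ⨾ v ⊆ v) where

    d : B
    d = v ∩ I

    S : B
    S = v ∩ R

    d⊆I : d ⊆ I
    d⊆I = ∩-lowerʳ v I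

    S⊆R : S ⊆ R
    S⊆R = ∩-lowerʳ v R

    S≡d⨾R : S ≡ d ⨾ R
    S≡d⨾R = sym (vector-∩I-⨾ v-vector R)

    Sᵀ≡Rᵀ⨾d : S ᵀ ≡ R ᵀ ⨾ d
    Sᵀ≡Rᵀ⨾d = trans (cong _ᵀ S≡d⨾R) (trans (ᵀ-⨾ d R) (cong (R ᵀ ⨾_) (subidentity-ᵀ d⊆I)))

    Sᵀ⨾L≡Rᵀ⨾v : S ᵀ ⨾ L ≡ R ᵀ ⨾ v
    Sᵀ⨾L≡Rᵀ⨾v = begin
      S ᵀ ⨾ L            ≡⟨ cong (_⨾ L) Sᵀ≡Rᵀ⨾d ⟩
      (R ᵀ ⨾ d) ⨾ L      ≡⟨ ⨾-assoc (R ᵀ) d L ⟩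
      R ᵀ ⨾ (d ⨾ L)      ≡⟨ cong (R ᵀ ⨾_) (trans (vector-∩I-⨾ v-vector L) (∩-identityʳ v)) ⟩
      R ᵀ ⨾ v            ∎
      where open ≡-Reasoning

    Sᵀ⨾L⊆v : S ᵀ ⨾ L ⊆ v
    Sᵀ⨾L⊆v = subst (_⊆ v) (sym Sᵀ⨾L≡Rᵀ⨾v) v-closed

    Sᵀ⊆d⨾Sᵀ : S ᵀ ⊆ d ⨾ S ᵀ
    Sᵀ⊆d⨾Sᵀ = subst (S ᵀ ⊆_) (sym (vector-∩I-⨾ v-vector (S ᵀ)))
                (∩-glb (⊆-trans (⊆-⨾L (S ᵀ)) Sᵀ⨾L⊆v) (⊆-refl (S ᵀ)))

    S⊆S⨾d : S ⊆ S ⨾ d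
    S⊆S⨾d = ᵀ-reflects-⊆ (subst (S ᵀ ⊆_) (sym (trans (ᵀ-⨾ S d) (cong (_⨾ S ᵀ) (subidentity-ᵀ d⊆I))))
                                Sᵀ⊆d⨾Sᵀ)

    d⨾R*⨾d⊆S* : d ⨾ (R * ⨾ d) ⊆ S *
    d⨾R*⨾d⊆S* = begin
      d ⨾ (R * ⨾ d)      ≤⟨ ⨾-monoʳ d (subidentity-⨾ʳ (R *) d⊆I) ⟩
      d ⨾ R *            ≤⟨ *-simulationʳ (subst (_⊆ S ⨾ d) S≡d⨾R S⊆S⨾d) ⟩
      S * ⨾ d            ≤⟨ subidentity-⨾ʳ (S *) d⊆I ⟩
      S *                ∎
      where open ⊆-Reasoning

    d⨾Rᵀ*⨾d⊆Sᵀ* : d ⨾ (R ᵀ* ⨾ d) ⊆ S ᵀ*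
    d⨾Rᵀ*⨾d⊆Sᵀ* = begin
      d ⨾ (R ᵀ* ⨾ d)     ≤⟨ ⨾-monoʳ d (*-simulationˡ (subst (_⊆ d ⨾ S ᵀ) Sᵀ≡Rᵀ⨾d Sᵀ⊆d⨾Sᵀ)) ⟩
      d ⨾ (d ⨾ S ᵀ*)     ≤⟨ subidentity-⨾ˡ (d ⨾ S ᵀ*) d⊆I ⟩
      d ⨾ S ᵀ*           ≤⟨ subidentity-⨾ˡ (S ᵀ*) d⊆I ⟩
      S ᵀ*               ∎
      where open ⊆-Reasoning

    restriction-connected : IsConnected R → IsConnected S
    restriction-connected R-connected = begin
      S ⨾ L ⨾ S                              ≤⟨ ⨾-mono (≡⇒⊆ S≡d⨾R) (⨾-monoʳ L (⊆-trans S⊆S⨾d (⨾-monoˡ d S⊆R))) ⟩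
      (d ⨾ R) ⨾ L ⨾ R ⨾ d                    ≈⟨ reassociate ⟩
      d ⨾ (R ⨾ L ⨾ R) ⨾ d                    ≤⟨ ⨾-monoʳ d (⨾-monoˡ d R-connected) ⟩
      d ⨾ (R * ∪ R ᵀ*) ⨾ d                   ≈⟨ trans (cong (d ⨾_) (⨾-distribʳ (R *) (R ᵀ*) d)) (⨾-distribˡ d _ _) ⟩
      d ⨾ (R * ⨾ d) ∪ d ⨾ (R ᵀ* ⨾ d)         ≤⟨ ∪-mono d⨾R*⨾d⊆S* d⨾Rᵀ*⨾d⊆Sᵀ* ⟩
      S * ∪ S ᵀ*                             ∎
      where
      open ⊆-Reasoning
      reassociate : (d ⨾ R) ⨾ L ⨾ R ⨾ d ≡ d ⨾ (R ⨾ L ⨾ R) ⨾ d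
      reassociate = trans (⨾-assoc d R _)
        (cong (d ⨾_) (trans (cong (R ⨾_) (sym (⨾-assoc L R d))) (sym (⨾-assoc R (L ⨾ R) d))))

    restriction-sp : ∀ {p} → v ⊆ p ∪ R ᵀ ⨾ v → sp S ⊆ p
    restriction-sp {p} v⊆p∪Rᵀ⨾v = shunting (begin
      S ⨾ L              ≤⟨ ⨾-monoˡ L (∩-lowerˡ v R) ⟩
      v ⨾ L              ≈⟨ v-vector ⟩
      v                  ≤⟨ v⊆p∪Rᵀ⨾v ⟩
      p ∪ R ᵀ ⨾ v        ≈⟨ cong (p ∪_) (sym Sᵀ⨾L≡Rᵀ⨾v) ⟩
      p ∪ S ᵀ ⨾ L        ∎)
      where open ⊆-Reasoning

    restriction-ep : ep S ⊆ ep R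
    restriction-ep = ∩-glb (⊆-trans (∩-lowerˡ _ _) (⨾-monoˡ L (ᵀ-mono S⊆R))) (disjoint⇒⊆∁ disjoint)
      where
      open ⊆-Reasoning
      end-of-R⊆S⨾L : S ᵀ ⨾ L ∩ R ⨾ L ⊆ S ⨾ L
      end-of-R⊆S⨾L = begin
        S ᵀ ⨾ L ∩ R ⨾ L      ≤⟨ ∩-mono Sᵀ⨾L⊆v (⊆-refl (R ⨾ L)) ⟩
        v ∩ R ⨾ L            ≈⟨ sym (vector-∩I-⨾ v-vector (R ⨾ L)) ⟩
        d ⨾ R ⨾ L            ≈⟨ sym (⨾-assoc d R L) ⟩
        (d ⨾ R) ⨾ L          ≈⟨ cong (_⨾ L) (sym S≡d⨾R) ⟩
        S ⨾ L                ∎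
      disjoint : ep S ∩ R ⨾ L ⊆ O
      disjoint = ⊆-∩-∁⇒⊆O
        (⊆-trans (∩-mono (∩-lowerˡ _ _) (⊆-refl (R ⨾ L))) end-of-R⊆S⨾L)
        (⊆-trans (∩-lowerˡ (ep S) _) (∩-lowerʳ _ _))

mainTheorem7 : ∀ {c : Level} (K : KleeneRelationAlgebra c) →
    let open KleeneRelationAlgebra K in
    ∀ (p R : B) → IsPoint p → IsPath R →
      IsPath (((R ᵀ*) ⨾ p) ∩ R)
      × sp (((R ᵀ*) ⨾ p) ∩ R) ⊆ p
      × ep (((R ᵀ*) ⨾ p) ∩ R) ⊆ ep R
mainTheorem7 K p R (p≡p⨾L , _ , _) (R-injective , R-univalent , R-connected) =
  ( (IsInjective-⊆ S⊆R R-injective , IsUnivalent-⊆ S⊆R R-univalent , restriction-connected R-connected)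
  , restriction-sp (*-⨾-unfold (R ᵀ) p)
  , restriction-ep )
  where
  open KleeneRelationAlgebra K
  open KleeneRelationAlgebraProperties K
  open Restriction (R ᵀ* ⨾ p) R (⨾-vector (R ᵀ*) (sym p≡p⨾L)) (*-⨾-closed (R ᵀ) p)
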